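{- Let $\mathcal{G}$ be a class of graphs closed under the addition of ears, and let $t$ be a constant. If every graph in $\mathcal{G}$ has an improper $t$-track layout, then every graph in $\mathcal{G}$ has a (proper) $t$-track layout.
   Context: Adding an ear to an edge $vw$ of a graph means adding a new vertex adjacent only to $v$ and $w$. A track assignment of $G$ is a partition $\{V_i\}$ of $V(G)$ with no edge inside a class, together with total orders $<_i$. An improper track assignment is a partition $\{V_i\}$ (edges may lie inside a class) with total orders $<_i$, such that for every edge $vw$ with $v,w\in V_i$ no vertex $x$ satisfies $v<_i x<_i w$. An X-crossing is a pair of edges $vw$, $xy$ with $v,x\in V_i$, $w,y\in V_j$, $i\ne j$, $v<_i x$, $y<_j w$. A (improper) $t$-track layout is a (improper) track assignment with $t$ classes and no X-crossing. -}

module Defs where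

open import Data.Nat using (ℕ; suc)
open import Data.Fin using (Fin; zero; suc; _≟_)
open import Data.Bool using (Bool; true; false; _∨_)
open import Data.Product using (Σ; _×_; _,_; ∃-syntax)
open import Data.Sum using (_⊎_)
open import Relation.Nullary using (¬_)
open import Relation.Nullary.Decidable using (⌊_⌋)
open import Relation.Binary.PropositionalEquality using (_≡_; _≢_; refl)

record Graph : Set where
  field
    n     : ℕ
    adj   : Fin n → Fin n → Bool
    sym   : ∀ a b → adj a b ≡ adj b a
    irr   : ∀ a → adj a a ≡ false

open Graph public

Edge : (G : Graph) → Fin (n G) → Fin (n G) → Set
Edge G v w = adj G v w ≡ true

-- Adding an ear to vw: a new vertex (here: zero; old vertices are shifted
-- by suc) adjacent exactly to v and w.
private
  isVW : ∀ {m} → Fin m → Fin m → Fin m → Bool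
  isVW v w a = ⌊ a ≟ v ⌋ ∨ ⌊ a ≟ w ⌋

  earAdj : (G : Graph) → Fin (n G) → Fin (n G) → Fin (suc (n G)) → Fin (suc (n G)) → Bool
  earAdj G v w zero    zero    = false
  earAdj G v w zero    (suc b) = isVW v w b
  earAdj G v w (suc a) zero    = isVW v w a
  earAdj G v w (suc a) (suc b) = adj G a b

  earSym : (G : Graph) (v w : Fin (n G)) → ∀ a b → earAdj G v w a b ≡ earAdj G v w b a
  earSym G v w zero    zero    = refl
  earSym G v w zero    (suc b) = refl
  earSym G v w (suc a) zero    = refl
  earSym G v w (suc a) (suc b) = sym G a b

  earIrr : (G : Graph) (v w : Fin (n G)) → ∀ a → earAdj G v w a a ≡ false
  earIrr G v w zero    = refl
  earIrr G v w (suc a) = irr G a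

addEar : (G : Graph) (v w : Fin (n G)) → Graph
addEar G v w = record
  { n = suc (n G) ; adj = earAdj G v w ; sym = earSym G v w ; irr = earIrr G v w }

EarClosed : (Graph → Set) → Set
EarClosed 𝒢 = ∀ G (v w : Fin (n G)) → Edge G v w → 𝒢 G → 𝒢 (addEar G v w)

-- A partition of V(G) into t (possibly empty) classes track⁻¹(i), together
-- with a strict total order on each class, given by one relation _≺_ that
-- only relates vertices of the same class.
record TrackOrder (t : ℕ) (G : Graph) : Set₁ where
  field
    track     : Fin (n G) → Fin t
    _≺_       : Fin (n G) → Fin (n G) → Set
    ≺-same    : ∀ {x y} → x ≺ y → track x ≡ track y
    ≺-irrefl  : ∀ x → ¬ (x ≺ x)
    ≺-trans   : ∀ {x y z} → x ≺ y → y ≺ z → x ≺ z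
    ≺-total   : ∀ x y → track x ≡ track y → x ≢ y → (x ≺ y) ⊎ (y ≺ x)

module _ {t : ℕ} {G : Graph} (T : TrackOrder t G) where
  open TrackOrder T

  IsProper : Set
  IsProper = ∀ v w → Edge G v w → track v ≢ track w

  IsImproper : Set
  IsImproper = ∀ v w → Edge G v w → track v ≡ track w →
               ¬ (Σ (Fin (n G)) λ x → (v ≺ x) × (x ≺ w))

  XCrossing : Set
  XCrossing = Σ (Fin (n G)) λ v → Σ (Fin (n G)) λ w → Σ (Fin (n G)) λ x → Σ (Fin (n G)) λ y →
    Edge G v w × Edge G x y × track v ≡ track x × track w ≡ track y ×
    track v ≢ track w × (v ≺ x) × (y ≺ w)

HasTrackLayout : ℕ → Graph → Set₁
HasTrackLayout t G = Σ (TrackOrder t G) λ T → IsProper T × ¬ XCrossing T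

HasImproperTrackLayout : ℕ → Graph → Set₁
HasImproperTrackLayout t G = Σ (TrackOrder t G) λ T → IsImproper T × ¬ XCrossing T

{-# OPTIONS --safe #-}
module Submission where

-- Repeatedly adding an ear to every edge of G stays inside 𝒢 and yields a
-- graph H ⊇ G in which every edge vw of G has t common neighbours. Take an
-- improper t-track layout of H. If v and w shared a track, no ear of vw could
-- join them there (the middle vertex of a triangle in one track lies between
-- two adjacent vertices), so the t ears occupy at most t − 1 tracks and two of
-- them share one; together with v and w they form a K₂,₂ between two tracks,
-- which is an X-crossing. Hence the layout of H restricted to G is proper.

open import Defs hiding (sym)
open import Data.Nat using (ℕ; zero; suc)
open import Data.Nat.Properties using (n<1+n)
open import Data.Fin using (Fin; zero; suc; _≟_; punchOut)
open import Data.Fin.Properties using (suc-injective; pigeonhole; punchOut-injective; <⇒≢)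
open import Data.Bool using (true; false; _∨_)
open import Data.Bool.Properties using (∨-zeroʳ)
open import Data.Product using (Σ; ∃₂; _×_; _,_)
open import Data.Sum using (inj₁; inj₂)
open import Data.List using (List; []; _∷_; cartesianProduct; allFin)
open import Data.List.Relation.Unary.Any using (here; there)
open import Data.List.Membership.Propositional using (_∈_)
open import Data.List.Membership.Propositional.Properties using (∈-cartesianProduct⁺; ∈-allFin)
open import Function using (_∘_)
open import Function.Definitions using (Injective)
open import Relation.Nullary using (¬_; contradiction)
open import Relation.Nullary.Decidable using (⌊_⌋)
open import Relation.Binary.PropositionalEquality
  using (_≡_; _≢_; refl; sym; trans; cong; ≡-≟-identity)

edge-sym : ∀ G {a b} → Edge G a b → Edge G b a
edge-sym G {a} {b} ab = trans (Graph.sym G b a) ab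

edge⇒≢ : ∀ G {a b} → Edge G a b → a ≢ b
edge⇒≢ G {a} ab refl with trans (sym ab) (irr G a)
... | ()

ear-edgeˡ : ∀ G (v w : Fin (n G)) → Edge (addEar G v w) zero (suc v)
ear-edgeˡ G v w = cong (λ d → ⌊ d ⌋ ∨ ⌊ v ≟ w ⌋) (≡-≟-identity _≟_ refl)

ear-edgeʳ : ∀ G (v w : Fin (n G)) → Edge (addEar G v w) zero (suc w)
ear-edgeʳ G v w = trans (cong (λ d → ⌊ w ≟ v ⌋ ∨ ⌊ d ⌋) (≡-≟-identity _≟_ refl)) (∨-zeroʳ _)

record _↪_ (G H : Graph) : Set where
  field
    to        : Fin (n G) → Fin (n H)
    injective : Injective _≡_ _≡_ to
    edge      : ∀ {a b} → Edge G a b → Edge H (to a) (to b)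

infix 4 _↪_

open _↪_

↪-refl : ∀ {G} → G ↪ G
↪-refl = record { to = λ a → a ; injective = λ eq → eq ; edge = λ ab → ab }

↪-trans : ∀ {G H K} → G ↪ H → H ↪ K → G ↪ K
↪-trans e g = record
  { to        = to g ∘ to e
  ; injective = injective e ∘ injective g
  ; edge      = edge g ∘ edge e
  }

addEar-↪ : ∀ G (v w : Fin (n G)) → G ↪ addEar G v w
addEar-↪ G v w = record { to = suc ; injective = suc-injective ; edge = λ ab → ab }

record CommonNeighbours (H : Graph) (a b : Fin (n H)) (k : ℕ) : Set where
  field
    neighbour : Fin k → Fin (n H)
    injective : Injective _≡_ _≡_ neighbour
    adjacentˡ : ∀ i → Edge H (neighbour i) a
    adjacentʳ : ∀ i → Edge H (neighbour i) b

no-commonNeighbours : ∀ {H} {a b : Fin (n H)} → CommonNeighbours H a b 0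
no-commonNeighbours = record
  { neighbour = λ () ; injective = λ { {()} } ; adjacentˡ = λ () ; adjacentʳ = λ () }

record FreshCommonNeighbour {H K} (g : H ↪ K) (a b : Fin (n H)) : Set where
  field
    vertex    : Fin (n K)
    adjacentˡ : Edge K vertex (to g a)
    adjacentʳ : Edge K vertex (to g b)
    fresh     : ∀ u → to g u ≢ vertex

fresh-↪-trans : ∀ {H K L} {g : H ↪ K} {a b} (h : K ↪ L) →
  FreshCommonNeighbour g a b → FreshCommonNeighbour (↪-trans g h) a b
fresh-↪-trans h z = record
  { vertex    = to h vertex
  ; adjacentˡ = edge h adjacentˡ
  ; adjacentʳ = edge h adjacentʳ
  ; fresh     = λ u → fresh u ∘ injective h
  }
  where open FreshCommonNeighbour z

extend-commonNeighbours : ∀ {H K} {g : H ↪ K} {a b k} →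
  FreshCommonNeighbour g a b → CommonNeighbours H a b k →
  CommonNeighbours K (to g a) (to g b) (suc k)
extend-commonNeighbours {g = g} z N = record
  { neighbour = neighbour′
  ; injective = injective′
  ; adjacentˡ = λ { zero → Z.adjacentˡ ; (suc i) → edge g (N.adjacentˡ i) }
  ; adjacentʳ = λ { zero → Z.adjacentʳ ; (suc i) → edge g (N.adjacentʳ i) }
  }
  where
  module Z = FreshCommonNeighbour z
  module N = CommonNeighbours N

  neighbour′ : Fin (suc _) → Fin _
  neighbour′ zero    = Z.vertex
  neighbour′ (suc i) = to g (N.neighbour i)

  injective′ : Injective _≡_ _≡_ neighbour′
  injective′ {zero}  {zero}  _  = refl
  injective′ {zero}  {suc j} eq = contradiction (sym eq) (Z.fresh (N.neighbour j))
  injective′ {suc i} {zero}  eq = contradiction eq (Z.fresh (N.neighbour i))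
  injective′ {suc i} {suc j} eq = cong suc (N.injective (injective g eq))

module EarClosure (𝒢 : Graph → Set) (closed : EarClosed 𝒢) where

  earsAlong : ∀ H → 𝒢 H → (L : List (Fin (n H) × Fin (n H))) →
    Σ Graph λ K → 𝒢 K × Σ (H ↪ K) λ g →
      ∀ {a b} → (a , b) ∈ L → Edge H a b → FreshCommonNeighbour g a b
  earsAlong H H∈𝒢 [] = H , H∈𝒢 , ↪-refl , λ ()
  earsAlong H H∈𝒢 ((a , b) ∷ L) with earsAlong H H∈𝒢 L | adj H a b in ab
  ... | K , K∈𝒢 , g , ears | false = K , K∈𝒢 , g , ears′
    where
    ears′ : ∀ {c d} → (c , d) ∈ (a , b) ∷ L → Edge H c d → FreshCommonNeighbour g c d
    ears′ (here refl) cd = contradiction (trans (sym cd) ab) λ ()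
    ears′ (there m)   cd = ears m cd
  ... | K , K∈𝒢 , g , ears | true =
    addEar K ga gb , closed K ga gb (edge g ab) K∈𝒢 , ↪-trans g ear , ears′
    where
    ga = to g a
    gb = to g b
    ear = addEar-↪ K ga gb

    ears′ : ∀ {c d} → (c , d) ∈ (a , b) ∷ L → Edge H c d →
      FreshCommonNeighbour (↪-trans g ear) c d
    ears′ (here refl) _  = record
      { vertex    = zero
      ; adjacentˡ = ear-edgeˡ K ga gb
      ; adjacentʳ = ear-edgeʳ K ga gb
      ; fresh     = λ _ ()
      }
    ears′ (there m)   cd = fresh-↪-trans ear (ears m cd)

  earOnEveryEdge : ∀ H → 𝒢 H →
    Σ Graph λ K → 𝒢 K × Σ (H ↪ K) λ g → ∀ a b → Edge H a b → FreshCommonNeighbour g a b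
  earOnEveryEdge H H∈𝒢 with earsAlong H H∈𝒢 (cartesianProduct (allFin (n H)) (allFin (n H)))
  ... | K , K∈𝒢 , g , ears =
    K , K∈𝒢 , g , λ a b → ears (∈-cartesianProduct⁺ (∈-allFin a) (∈-allFin b))

  earSaturation : ∀ k G → 𝒢 G →
    Σ Graph λ H → 𝒢 H × Σ (G ↪ H) λ e →
      ∀ v w → Edge G v w → CommonNeighbours H (to e v) (to e w) k
  earSaturation zero    G G∈𝒢 = G , G∈𝒢 , ↪-refl , λ _ _ _ → no-commonNeighbours
  earSaturation (suc k) G G∈𝒢 with earSaturation k G G∈𝒢
  ... | H , H∈𝒢 , e , N with earOnEveryEdge H H∈𝒢
  ... | K , K∈𝒢 , g , ear =
    K , K∈𝒢 , ↪-trans e g , λ v w vw → extend-commonNeighbours (ear _ _ (edge e vw)) (N v w vw)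

missed-value⇒collision : ∀ {t} {c : Fin t} (f : Fin t → Fin t) → (∀ i → c ≢ f i) →
  ∃₂ λ i j → i ≢ j × f i ≡ f j
missed-value⇒collision {zero} {()}
missed-value⇒collision {suc t} f c∉f with pigeonhole (n<1+n t) (λ i → punchOut (c∉f i))
... | i , j , i<j , same = i , j , <⇒≢ i<j , punchOut-injective (c∉f i) (c∉f j) same

pullback : ∀ {t G H} → TrackOrder t H → G ↪ H → TrackOrder t G
pullback T e = record
  { track    = track ∘ to e
  ; _≺_      = λ a b → to e a ≺ to e b
  ; ≺-same   = ≺-same
  ; ≺-irrefl = ≺-irrefl ∘ to e
  ; ≺-trans  = ≺-trans
  ; ≺-total  = λ a b same a≢b → ≺-total (to e a) (to e b) same (a≢b ∘ injective e)
  }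
  where open TrackOrder T

pullback-¬XCrossing : ∀ {t G H} (T : TrackOrder t H) (e : G ↪ H) →
  ¬ XCrossing T → ¬ XCrossing (pullback T e)
pullback-¬XCrossing T e noX (v , w , x , y , vw , xy , rest) =
  noX (to e v , to e w , to e x , to e y , edge e vw , edge e xy , rest)

module _ {t H} (T : TrackOrder t H) where
  open TrackOrder T

  private
    K₂,₂-ordered⇒XCrossing : ∀ {x y v w} → x ≺ y → track x ≢ track v → track v ≡ track w → v ≢ w →
      Edge H x v → Edge H x w → Edge H y v → Edge H y w → XCrossing T
    K₂,₂-ordered⇒XCrossing {x} {y} {v} {w} x≺y tx≢tv tv≡tw v≢w xv xw yv yw
      with ≺-total v w tv≡tw v≢w
    ... | inj₁ v≺w =
      x , w , y , v , xw , yv , ≺-same x≺y , sym tv≡tw , tx≢tv ∘ (λ q → trans q (sym tv≡tw)) , x≺y , v≺w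
    ... | inj₂ w≺v = x , v , y , w , xv , yw , ≺-same x≺y , tv≡tw , tx≢tv , x≺y , w≺v

  K₂,₂⇒XCrossing : ∀ {x y v w} → x ≢ y → v ≢ w →
    track x ≡ track y → track v ≡ track w → track x ≢ track v →
    Edge H x v → Edge H x w → Edge H y v → Edge H y w → XCrossing T
  K₂,₂⇒XCrossing x≢y v≢w tx≡ty tv≡tw tx≢tv xv xw yv yw with ≺-total _ _ tx≡ty x≢y
  ... | inj₁ x≺y = K₂,₂-ordered⇒XCrossing x≺y tx≢tv tv≡tw v≢w xv xw yv yw
  ... | inj₂ y≺x = K₂,₂-ordered⇒XCrossing y≺x (tx≢tv ∘ trans tx≡ty) tv≡tw v≢w yv yw xv xw

  module _ (improper : IsImproper T) where

    private
      ¬edge-over : ∀ {a b c} → a ≺ b → b ≺ c → ¬ Edge H a c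
      ¬edge-over a≺b b≺c ac = improper _ _ ac (trans (≺-same a≺b) (≺-same b≺c)) (_ , a≺b , b≺c)

      ¬triangle-ordered : ∀ {x v w} → v ≺ w → track x ≡ track v →
        Edge H x v → Edge H x w → ¬ Edge H v w
      ¬triangle-ordered {x} {v} {w} v≺w tx≡tv xv xw vw with ≺-total x v tx≡tv (edge⇒≢ H xv)
      ... | inj₁ x≺v = ¬edge-over x≺v v≺w xw
      ... | inj₂ v≺x with ≺-total x w (trans tx≡tv (≺-same v≺w)) (edge⇒≢ H xw)
      ...   | inj₁ x≺w = ¬edge-over v≺x x≺w vw
      ...   | inj₂ w≺x = ¬edge-over v≺w w≺x (edge-sym H xv)

    triangle-off-track : ∀ {x v w} → track v ≡ track w →
      Edge H x v → Edge H x w → Edge H v w → track v ≢ track x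
    triangle-off-track {x} {v} {w} tv≡tw xv xw vw tv≡tx with ≺-total v w tv≡tw (edge⇒≢ H vw)
    ... | inj₁ v≺w = ¬triangle-ordered v≺w (sym tv≡tx) xv xw vw
    ... | inj₂ w≺v = ¬triangle-ordered w≺v (trans (sym tv≡tx) tv≡tw) xw xv (edge-sym H vw)

    commonNeighbours⇒XCrossing : ∀ {v w} → Edge H v w → track v ≡ track w →
      CommonNeighbours H v w t → XCrossing T
    commonNeighbours⇒XCrossing {v} vw tv≡tw N =
      collision⇒XCrossing (missed-value⇒collision (track ∘ neighbour) off-track)
      where
      open CommonNeighbours N renaming (injective to neighbour-injective)

      off-track : ∀ i → track v ≢ track (neighbour i)
      off-track i = triangle-off-track tv≡tw (adjacentˡ i) (adjacentʳ i) vw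

      collision⇒XCrossing : (∃₂ λ i j → i ≢ j × track (neighbour i) ≡ track (neighbour j)) →
        XCrossing T
      collision⇒XCrossing (i , j , i≢j , same) =
        K₂,₂⇒XCrossing (i≢j ∘ neighbour-injective) (edge⇒≢ H vw) same tv≡tw (off-track i ∘ sym)
          (adjacentˡ i) (adjacentʳ i) (adjacentˡ j) (adjacentʳ j)

pullback-proper : ∀ {t G H} (T : TrackOrder t H) (e : G ↪ H) → IsImproper T → ¬ XCrossing T →
  (∀ v w → Edge G v w → CommonNeighbours H (to e v) (to e w) t) → IsProper (pullback T e)
pullback-proper T e improper noX ears v w vw tv≡tw =
  noX (commonNeighbours⇒XCrossing T improper (edge e vw) tv≡tw (ears v w vw))

lemma2p3 : (𝒢 : Graph → Set) → EarClosed 𝒢 → (t : ℕ) →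
    (∀ G → 𝒢 G → HasImproperTrackLayout t G) →
    ∀ G → 𝒢 G → HasTrackLayout t G
lemma2p3 𝒢 closed t layout G G∈𝒢 with EarClosure.earSaturation 𝒢 closed t G G∈𝒢
... | H , H∈𝒢 , e , ears with layout H H∈𝒢
... | T , improper , noX =
  pullback T e , pullback-proper T e improper noX ears , pullback-¬XCrossing T e noX
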